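{- Let $k\ge1$ and let $G=([N],E)$ be a graph of maximum degree $d$. Consider the test that selects a start vertex $s\in[N]$ uniformly at random, performs a random walk of $k$ steps from $s$ (at each step moving to a uniformly random neighbor of the current vertex), and rejects if and only if the walk traverses a simple path of length $k$. If $G$ is $\epsilon$-far from being $P_k$-minor free, then this test rejects with probability at least $\epsilon/(2d^k)$.
   Context: $P_k$ denotes the path with $k$ edges; a graph is $P_k$-minor free iff it contains no simple path of length $k$. $G$ is $\epsilon$-far from being $P_k$-minor free if for every $P_k$-minor free $G'=([N],E')$ the symmetric difference of $E$ and $E'$ has more than $\epsilon dN$ elements.
   Formalization: The proximity parameter ε ranges over the rationals, both in the definition of being ε-far and in the bound ε/(2d^k). -}

module Defs where

open import Data.Nat as ℕ using (ℕ; zero; suc; _<ᵇ_)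
open import Data.Fin as Fin using (Fin; zero; suc; toℕ; inject₁)
open import Data.Bool using (Bool; true; false; if_then_else_; _∧_; _∨_; _xor_; not)
open import Data.Rational using (ℚ; 0ℚ; 1ℚ; _+_; _*_; _/_; _≤_; _<_)
open import Data.Integer using (+_)
open import Data.Vec.Functional using (Vector; _∷_)
open import Data.Product using (_×_)
open import Relation.Nullary using (¬_)
open import Relation.Nullary.Decidable using (⌊_⌋)
open import Relation.Binary.PropositionalEquality using (_≡_)

record Graph (N : ℕ) : Set where
  field
    adj        : Fin N → Fin N → Bool
    adj-sym    : ∀ i j → adj i j ≡ adj j i
    adj-irrefl : ∀ i → adj i i ≡ false
open Graph public

sumℕ : ∀ {n} → (Fin n → ℕ) → ℕ
sumℕ {zero}  f = 0
sumℕ {suc n} f = f zero ℕ.+ sumℕ (λ i → f (suc i))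

sumℚ : ∀ {n} → (Fin n → ℚ) → ℚ
sumℚ {zero}  f = 0ℚ
sumℚ {suc n} f = f zero + sumℚ (λ i → f (suc i))

prodℚ : ∀ {n} → (Fin n → ℚ) → ℚ
prodℚ {zero}  f = 1ℚ
prodℚ {suc n} f = f zero * prodℚ (λ i → f (suc i))

allB : ∀ {n} → (Fin n → Bool) → Bool
allB {zero}  f = true
allB {suc n} f = f zero ∧ allB (λ i → f (suc i))

-- natural number as a rational, and reciprocal (with 1/0 := 0, never used
-- in a relevant way)
ℕtoℚ : ℕ → ℚ
ℕtoℚ n = (+ n) / 1

inv : ℕ → ℚ
inv zero    = 0ℚ
inv (suc n) = (+ 1) / suc n

deg : ∀ {N} → Graph N → Fin N → ℕ
deg G v = sumℕ (λ u → if adj G v u then 1 else 0)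

MaxDegree≤ : ∀ {N} → Graph N → ℕ → Set
MaxDegree≤ G d = ∀ v → deg G v ℕ.≤ d

IsSimplePath : ∀ {N} → Graph N → (k : ℕ) → (Fin (suc k) → Fin N) → Set
IsSimplePath G k p =
  (∀ i j → p i ≡ p j → i ≡ j) ×
  (∀ (i : Fin k) → adj G (p (inject₁ i)) (p (suc i)) ≡ true)

-- P_k-minor free  ⇔  no simple path of length k
PkMinorFree : ∀ {N} → ℕ → Graph N → Set
PkMinorFree k G = ∀ p → ¬ IsSimplePath G k p

edgeDist : ∀ {N} → Graph N → Graph N → ℕ
edgeDist G G' = sumℕ (λ i → sumℕ (λ j →
  if (toℕ i <ᵇ toℕ j) ∧ (adj G i j xor adj G' i j) then 1 else 0))

-- G is ε-far from P_k-minor free (bounded-degree model, degree bound d)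
EpsFar : ∀ {N} → ℚ → ℕ → ℕ → Graph N → Set
EpsFar {N} ε d k G =
  ∀ (G' : Graph N) → PkMinorFree k G' → ε * ℕtoℚ (d ℕ.* N) < ℕtoℚ (edgeDist G G')

sumSeq : (N m : ℕ) → (Vector (Fin N) m → ℚ) → ℚ
sumSeq N zero    f = f (λ ())
sumSeq N (suc m) f = sumℚ (λ x → sumSeq N m (λ w → f (x ∷ w)))

-- probability that the test (uniform start, k uniform-neighbour steps)
-- produces exactly the vertex sequence w = (w 0, ..., w k)
walkProb : ∀ {N} → Graph N → (k : ℕ) → (Fin (suc k) → Fin N) → ℚ
walkProb {N} G k w = inv N * prodℚ (λ (i : Fin k) →
  if adj G (w (inject₁ i)) (w (suc i)) then inv (deg G (w (inject₁ i))) else 0ℚ)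

distinctB : ∀ {N m} → (Fin m → Fin N) → Bool
distinctB w = allB (λ i → allB (λ j → ⌊ i Fin.≟ j ⌋ ∨ not ⌊ w i Fin.≟ w j ⌋))

rejectProb : ∀ {N} → Graph N → ℕ → ℚ
rejectProb {N} G k =
  sumSeq N (suc k) (λ w → if distinctB w then walkProb G k w else 0ℚ)

module Submission where

-- Let c(x) be the number of simple k-paths (as vertex sequences) that start
-- at x, and P = Σₓ c(x).  Deleting every edge incident to a vertex x with
-- c(x) > 0 leaves a graph with no simple k-path (the first vertex of such a
-- path would still start a path in G, yet it keeps an edge), and costs at
-- most Σ_{ij ∈ E} (c(i) + c(j)) ≤ 2dP edge modifications.  Hence ε-farness
-- gives ε·d·N < 2dP.  On the other hand, every simple k-path is walked with
-- probability at least 1/(N·dᵏ), since each step has probability 1/deg ≥ 1/d;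
-- so the rejection probability is at least P/(N·dᵏ) ≥ ε/(2dᵏ).

open import Defs
open import Data.Nat using (ℕ; _≤_; _*_; _^_)
open import Data.Rational using (ℚ) renaming (_≤_ to _≤ℚ_; _*_ to _*ℚ_)

open import Data.Nat using (zero; suc; _+_; _<ᵇ_; z≤n; s≤s)
import Data.Nat.Properties as ℕP
import Data.Integer as ℤ
import Data.Integer.Properties as ℤP
import Data.Rational as Q
open import Data.Rational using (0ℚ; 1ℚ; mkℚ) renaming (_+_ to _+ℚ_)
import Data.Rational.Properties as QP
open import Data.Rational.Solver using (module +-*-Solver)
open +-*-Solver using (solve; _:=_; _:*_; _:+_; con)
import Data.Nat.Coprimality as Coprime
import Algebra.Properties.Semiring.Sum as SemiringSum
open import Data.Fin as Fin using (Fin; zero; suc; inject₁)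
open import Data.Bool using (Bool; true; false; if_then_else_; _∧_; _∨_; _xor_; not)
import Data.Bool.Properties as BoolP
open import Data.Vec.Functional using (Vector; _∷_)
open import Data.Product using (_,_; proj₂)
open import Data.Empty using (⊥; ⊥-elim)
open import Relation.Nullary using (¬_; yes; no)
open import Relation.Nullary.Decidable using (⌊_⌋)
open import Relation.Binary.PropositionalEquality

module Σℕ = SemiringSum ℕP.+-*-semiring

sumℕ≡∑ : ∀ {n} (f : Fin n → ℕ) → sumℕ f ≡ Σℕ.sum f
sumℕ≡∑ {zero}  f = refl
sumℕ≡∑ {suc n} f = cong (f zero +_) (sumℕ≡∑ (λ i → f (suc i)))

sumℕ-cong : ∀ {n} {f g : Fin n → ℕ} → (∀ i → f i ≡ g i) → sumℕ f ≡ sumℕ g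
sumℕ-cong {f = f} {g} f≗g = trans (sumℕ≡∑ f) (trans (Σℕ.sum-cong-≗ f≗g) (sym (sumℕ≡∑ g)))

sumℕ-+ : ∀ {n} (f g : Fin n → ℕ) → sumℕ (λ i → f i + g i) ≡ sumℕ f + sumℕ g
sumℕ-+ f g = begin
  sumℕ (λ i → f i + g i)      ≡⟨ sumℕ≡∑ (λ i → f i + g i) ⟩
  Σℕ.sum (λ i → f i + g i)    ≡⟨ Σℕ.∑-distrib-+ f g ⟩
  Σℕ.sum f + Σℕ.sum g         ≡⟨ sym (cong₂ _+_ (sumℕ≡∑ f) (sumℕ≡∑ g)) ⟩
  sumℕ f + sumℕ g             ∎
  where open ≡-Reasoning

sumℕ-*ʳ : ∀ {n} (f : Fin n → ℕ) c → sumℕ (λ i → f i * c) ≡ sumℕ f * c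
sumℕ-*ʳ f c = begin
  sumℕ (λ i → f i * c)     ≡⟨ sumℕ≡∑ (λ i → f i * c) ⟩
  Σℕ.sum (λ i → f i * c)   ≡⟨ sym (Σℕ.*-distribʳ-sum c f) ⟩
  Σℕ.sum f * c             ≡⟨ cong (_* c) (sym (sumℕ≡∑ f)) ⟩
  sumℕ f * c               ∎
  where open ≡-Reasoning

sumℕ-*ˡ : ∀ {n} c (f : Fin n → ℕ) → sumℕ (λ i → c * f i) ≡ c * sumℕ f
sumℕ-*ˡ c f = begin
  sumℕ (λ i → c * f i)     ≡⟨ sumℕ≡∑ (λ i → c * f i) ⟩
  Σℕ.sum (λ i → c * f i)   ≡⟨ sym (Σℕ.*-distribˡ-sum c f) ⟩
  c * Σℕ.sum f             ≡⟨ cong (c *_) (sym (sumℕ≡∑ f)) ⟩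
  c * sumℕ f               ∎
  where open ≡-Reasoning

sumℕ-comm : ∀ {m n} (f : Fin m → Fin n → ℕ) →
  sumℕ (λ i → sumℕ (λ j → f i j)) ≡ sumℕ (λ j → sumℕ (λ i → f i j))
sumℕ-comm f = begin
  sumℕ (λ i → sumℕ (f i))                    ≡⟨ double f ⟩
  Σℕ.sum (λ i → Σℕ.sum (f i))                ≡⟨ Σℕ.∑-comm f ⟩
  Σℕ.sum (λ j → Σℕ.sum (λ i → f i j))        ≡⟨ sym (double (λ j i → f i j)) ⟩
  sumℕ (λ j → sumℕ (λ i → f i j))            ∎
  where
  open ≡-Reasoning
  double : ∀ {m n} (g : Fin m → Fin n → ℕ) →
    sumℕ (λ i → sumℕ (g i)) ≡ Σℕ.sum (λ i → Σℕ.sum (g i))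
  double g = trans (sumℕ≡∑ (λ i → sumℕ (g i))) (Σℕ.sum-cong-≗ (λ i → sumℕ≡∑ (g i)))

sumℕ-mono : ∀ {n} {f g : Fin n → ℕ} → (∀ i → f i ≤ g i) → sumℕ f ≤ sumℕ g
sumℕ-mono {zero}  f≤g = z≤n
sumℕ-mono {suc n} f≤g = ℕP.+-mono-≤ (f≤g zero) (sumℕ-mono (λ i → f≤g (suc i)))

term≤sumℕ : ∀ {n} (f : Fin n → ℕ) i → f i ≤ sumℕ f
term≤sumℕ f zero    = ℕP.m≤m+n _ _
term≤sumℕ f (suc i) = ℕP.≤-trans (term≤sumℕ (λ i → f (suc i)) i) (ℕP.m≤n+m _ (f zero))

sumSeqℕ : (N m : ℕ) → (Vector (Fin N) m → ℕ) → ℕ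
sumSeqℕ N zero    f = f (λ ())
sumSeqℕ N (suc m) f = sumℕ (λ x → sumSeqℕ N m (λ w → f (x ∷ w)))

-- f only depends on the entries of its argument (functions on Fin have no
-- η-law, so v and `v zero ∷ tail v` are merely pointwise equal).
Extensional : ∀ {N m} → (Vector (Fin N) m → ℕ) → Set
Extensional {N} {m} f = ∀ {v v' : Vector (Fin N) m} → (∀ i → v i ≡ v' i) → f v ≡ f v'

term≤sumSeqℕ : ∀ {N} m (f : Vector (Fin N) m → ℕ) → Extensional f →
  ∀ v → f v ≤ sumSeqℕ N m f
term≤sumSeqℕ zero    f ext v = ℕP.≤-reflexive (ext (λ ()))
term≤sumSeqℕ (suc m) f ext v = begin
  f v                                         ≡⟨ ext split ⟩
  f (v zero ∷ tail)                           ≤⟨ term≤sumSeqℕ m _ ext-tail tail ⟩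
  sumSeqℕ _ m (λ w → f (v zero ∷ w))          ≤⟨ term≤sumℕ (λ x → sumSeqℕ _ m (λ w → f (x ∷ w))) (v zero) ⟩
  sumSeqℕ _ (suc m) f                         ∎
  where
  open ℕP.≤-Reasoning
  tail = λ i → v (suc i)
  split : ∀ i → v i ≡ (v zero ∷ tail) i
  split zero    = refl
  split (suc i) = refl
  ext-tail : Extensional (λ w → f (v zero ∷ w))
  ext-tail eq = ext (λ { zero → refl ; (suc i) → eq i })

allB-cong : ∀ {n} {f g : Fin n → Bool} → (∀ i → f i ≡ g i) → allB f ≡ allB g
allB-cong {zero}  f≡g = refl
allB-cong {suc n} f≡g = cong₂ _∧_ (f≡g zero) (allB-cong (λ i → f≡g (suc i)))

allB-intro : ∀ {n} {f : Fin n → Bool} → (∀ i → f i ≡ true) → allB f ≡ true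
allB-intro {zero}  h = refl
allB-intro {suc n} h rewrite h zero = allB-intro (λ i → h (suc i))

allB-elim : ∀ {n} {f : Fin n → Bool} → allB f ≡ true → ∀ i → f i ≡ true
allB-elim {suc n} {f} h i with f zero in eq
allB-elim {suc n} {f} h zero    | true = eq
allB-elim {suc n} {f} h (suc i) | true = allB-elim h i

∧-elimˡ : ∀ {a b} → a ∧ b ≡ true → a ≡ true
∧-elimˡ {true} h = refl

𝟙 : Bool → ℕ
𝟙 b = if b then 1 else 0

module SimplePaths {N : ℕ} (G : Graph N) (k : ℕ) where

  isWalkB : (Fin (suc k) → Fin N) → Bool
  isWalkB w = allB (λ (i : Fin k) → adj G (w (inject₁ i)) (w (suc i)))

  isSimplePathB : (Fin (suc k) → Fin N) → Bool
  isSimplePathB w = distinctB w ∧ isWalkB w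

  isSimplePathB-ext : ∀ {v v'} → (∀ i → v i ≡ v' i) → isSimplePathB v ≡ isSimplePathB v'
  isSimplePathB-ext v≗v' = cong₂ _∧_
    (allB-cong (λ i → allB-cong (λ j →
      cong₂ (λ a b → ⌊ i Fin.≟ j ⌋ ∨ not ⌊ a Fin.≟ b ⌋) (v≗v' i) (v≗v' j))))
    (allB-cong (λ i → cong₂ (adj G) (v≗v' (inject₁ i)) (v≗v' (suc i))))

  isSimplePathB-complete : ∀ p → IsSimplePath G k p → isSimplePathB p ≡ true
  isSimplePathB-complete p (injective , edges) =
    cong₂ _∧_ (allB-intro (λ i → allB-intro (λ j → distinct i j))) (allB-intro edges)
    where
    distinct : ∀ i j → (⌊ i Fin.≟ j ⌋ ∨ not ⌊ p i Fin.≟ p j ⌋) ≡ true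
    distinct i j with i Fin.≟ j
    ... | yes _   = refl
    ... | no i≢j with p i Fin.≟ p j
    ...   | yes pi≡pj = ⊥-elim (i≢j (injective i j pi≡pj))
    ...   | no _      = refl

  pathsFrom : Fin N → ℕ
  pathsFrom x = sumSeqℕ N k (λ w → 𝟙 (isSimplePathB (x ∷ w)))

  totalPaths : ℕ
  totalPaths = sumℕ pathsFrom

  pathsFrom-start : ∀ p → isSimplePathB p ≡ true → 1 ≤ pathsFrom (p zero)
  pathsFrom-start p simple = begin
    1                                       ≡⟨ cong 𝟙 (sym simple) ⟩
    𝟙 (isSimplePathB p)                     ≡⟨ cong 𝟙 (isSimplePathB-ext {p} {p zero ∷ tail} split) ⟩
    𝟙 (isSimplePathB (p zero ∷ tail))       ≤⟨ term≤sumSeqℕ k _ ext tail ⟩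
    pathsFrom (p zero)                      ∎
    where
    open ℕP.≤-Reasoning
    tail = λ i → p (suc i)
    split : ∀ i → p i ≡ (p zero ∷ tail) i
    split zero    = refl
    split (suc i) = refl
    ext : Extensional (λ w → 𝟙 (isSimplePathB (p zero ∷ w)))
    ext {v} {v'} eq = cong 𝟙 (isSimplePathB-ext {p zero ∷ v} {p zero ∷ v'} (λ { zero → refl ; (suc i) → eq i }))

isZero : ℕ → Bool
isZero zero    = true
isZero (suc _) = false

module Repair {N : ℕ} (G : Graph N) (k : ℕ) where
  open SimplePaths G k

  free : Fin N → Bool
  free x = isZero (pathsFrom x)

  repaired : Graph N
  repaired = record
    { adj        = λ i j → adj G i j ∧ (free i ∧ free j)
    ; adj-sym    = λ i j → cong₂ _∧_ (adj-sym G i j) (BoolP.∧-comm (free i) (free j))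
    ; adj-irrefl = λ i → cong (_∧ (free i ∧ free i)) (adj-irrefl G i)
    }

  simple-in-G : ∀ p → IsSimplePath repaired k p → IsSimplePath G k p
  simple-in-G p (injective , edges) = injective , λ i → ∧-elimˡ (edges i)

  start-isolated : ∀ p → IsSimplePath G k p → ∀ v → adj repaired (p zero) v ≡ false
  start-isolated p simple v
    with pathsFrom (p zero) | pathsFrom-start p (isSimplePathB-complete p simple)
  ... | suc _ | _ = BoolP.∧-zeroʳ (adj G (p zero) v)

  -- an unordered pair changes only if it is an edge with a non-free end,
  -- and such an edge is paid for by the paths starting at its ends
  pair-cost : ∀ i j →
    𝟙 ((Fin.toℕ i <ᵇ Fin.toℕ j) ∧ (adj G i j xor adj repaired i j))
      ≤ 𝟙 (adj G i j) * (pathsFrom i + pathsFrom j)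
  pair-cost i j with Fin.toℕ i <ᵇ Fin.toℕ j
  ... | false = z≤n
  ... | true = cost (adj G i j) (pathsFrom i) (pathsFrom j)
    where
    cost : ∀ a ci cj → 𝟙 (a xor (a ∧ (isZero ci ∧ isZero cj))) ≤ 𝟙 a * (ci + cj)
    cost false _       _       = z≤n
    cost true  zero    zero    = z≤n
    cost true  (suc _) _       = s≤s z≤n
    cost true  zero    (suc _) = s≤s z≤n

  degree-weighted : ∀ d → MaxDegree≤ G d →
    sumℕ (λ i → sumℕ (λ j → 𝟙 (adj G i j) * pathsFrom i)) ≤ d * totalPaths
  degree-weighted d maxdeg = begin
    sumℕ (λ i → sumℕ (λ j → 𝟙 (adj G i j) * pathsFrom i))
      ≡⟨ sumℕ-cong (λ i → sumℕ-*ʳ (λ j → 𝟙 (adj G i j)) (pathsFrom i)) ⟩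
    sumℕ (λ i → deg G i * pathsFrom i)
      ≤⟨ sumℕ-mono (λ i → ℕP.*-monoˡ-≤ (pathsFrom i) (maxdeg i)) ⟩
    sumℕ (λ i → d * pathsFrom i)
      ≡⟨ sumℕ-*ˡ d pathsFrom ⟩
    d * totalPaths ∎
    where open ℕP.≤-Reasoning

  repair-cost : ∀ d → MaxDegree≤ G d →
    edgeDist G repaired ≤ d * totalPaths + d * totalPaths
  repair-cost d maxdeg = begin
    edgeDist G repaired
      ≤⟨ sumℕ-mono (λ i → sumℕ-mono (λ j → pair-cost i j)) ⟩
    sumℕ (λ i → sumℕ (λ j → a i j * (c i + c j)))
      ≡⟨ sumℕ-cong (λ i → trans (sumℕ-cong (λ j → ℕP.*-distribˡ-+ (a i j) (c i) (c j)))
                                 (sumℕ-+ (λ j → a i j * c i) (λ j → a i j * c j))) ⟩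
    sumℕ (λ i → sumℕ (λ j → a i j * c i) + sumℕ (λ j → a i j * c j))
      ≡⟨ sumℕ-+ (λ i → sumℕ (λ j → a i j * c i)) (λ i → sumℕ (λ j → a i j * c j)) ⟩
    sumℕ (λ i → sumℕ (λ j → a i j * c i)) + sumℕ (λ i → sumℕ (λ j → a i j * c j))
      ≡⟨ cong (sumℕ (λ i → sumℕ (λ j → a i j * c i)) +_) by-symmetry ⟩
    sumℕ (λ i → sumℕ (λ j → a i j * c i)) + sumℕ (λ j → sumℕ (λ i → a j i * c j))
      ≤⟨ ℕP.+-mono-≤ (degree-weighted d maxdeg) (degree-weighted d maxdeg) ⟩
    d * totalPaths + d * totalPaths ∎
    where
    open ℕP.≤-Reasoning
    a = λ i j → 𝟙 (adj G i j)
    c = pathsFrom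
    by-symmetry : sumℕ (λ i → sumℕ (λ j → a i j * c j)) ≡ sumℕ (λ j → sumℕ (λ i → a j i * c j))
    by-symmetry = trans (sumℕ-comm (λ i j → a i j * c j))
      (sumℕ-cong (λ j → sumℕ-cong (λ i → cong (λ b → 𝟙 b * c j) (adj-sym G i j))))

-- the repaired graph is P_k-minor free, as every simple path has a first edge
repaired-free : ∀ {N} (G : Graph N) k → 1 ≤ k → PkMinorFree k (Repair.repaired G k)
repaired-free G (suc k) _ p simple
  with () ← trans (sym (proj₂ simple zero))
                  (Repair.start-isolated G (suc k) p (Repair.simple-in-G G (suc k) p simple) (p (suc zero)))

-- the normal form of ℕtoℚ n, on which ℚ arithmetic computes
ℕtoℚ-mkℚ : ∀ n → ℕtoℚ n ≡ mkℚ (ℤ.+ n) 0 (Coprime.sym (Coprime.1-coprimeTo n))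
ℕtoℚ-mkℚ n = QP.normalize-coprime (Coprime.sym (Coprime.1-coprimeTo n))

inv-mkℚ : ∀ n → inv (suc n) ≡ Q.1/ mkℚ (ℤ.+ suc n) 0 (Coprime.sym (Coprime.1-coprimeTo (suc n)))
inv-mkℚ n = QP.normalize-coprime (Coprime.1-coprimeTo (suc n))

ℕtoℚ-+ : ∀ a b → ℕtoℚ (a + b) ≡ ℕtoℚ a +ℚ ℕtoℚ b
ℕtoℚ-+ a b = begin
  ℤ.+ (a + b) Q./ 1                               ≡⟨ QP./-cong integers refl ⟩
  (ℤ.+ a ℤ.* ℤ.+ 1 ℤ.+ ℤ.+ b ℤ.* ℤ.+ 1) Q./ 1     ≡⟨ sym (cong₂ _+ℚ_ (ℕtoℚ-mkℚ a) (ℕtoℚ-mkℚ b)) ⟩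
  ℕtoℚ a +ℚ ℕtoℚ b                                ∎
  where
  open ≡-Reasoning
  integers : ℤ.+ (a + b) ≡ ℤ.+ a ℤ.* ℤ.+ 1 ℤ.+ ℤ.+ b ℤ.* ℤ.+ 1
  integers = trans (ℤP.pos-+ a b)
    (sym (cong₂ ℤ._+_ (ℤP.*-identityʳ (ℤ.+ a)) (ℤP.*-identityʳ (ℤ.+ b))))

ℕtoℚ-* : ∀ a b → ℕtoℚ (a * b) ≡ ℕtoℚ a *ℚ ℕtoℚ b
ℕtoℚ-* a b = begin
  ℤ.+ (a * b) Q./ 1           ≡⟨ QP./-cong (ℤP.pos-* a b) refl ⟩
  (ℤ.+ a ℤ.* ℤ.+ b) Q./ 1     ≡⟨ sym (cong₂ _*ℚ_ (ℕtoℚ-mkℚ a) (ℕtoℚ-mkℚ b)) ⟩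
  ℕtoℚ a *ℚ ℕtoℚ b            ∎
  where open ≡-Reasoning

ℕtoℚ-mono : ∀ {a b} → a ≤ b → ℕtoℚ a ≤ℚ ℕtoℚ b
ℕtoℚ-mono {a} {b} a≤b = subst₂ _≤ℚ_ (sym (ℕtoℚ-mkℚ a)) (sym (ℕtoℚ-mkℚ b))
  (Q.*≤* (subst₂ ℤ._≤_ (sym (ℤP.*-identityʳ (ℤ.+ a))) (sym (ℤP.*-identityʳ (ℤ.+ b))) (ℤ.+≤+ a≤b)))

inv-nonNeg : ∀ n → Q.NonNegative (inv n)
inv-nonNeg zero    = _
inv-nonNeg (suc n) = QP.normalize-nonNeg 1 (suc n)

0≤inv : ∀ n → 0ℚ ≤ℚ inv n
0≤inv n = QP.nonNegative⁻¹ (inv n) {{inv-nonNeg n}}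

inv-antitone : ∀ {a b} → a ≤ b → inv (suc b) ≤ℚ inv (suc a)
inv-antitone {a} {b} a≤b = subst₂ _≤ℚ_ (sym (inv-mkℚ b)) (sym (inv-mkℚ a))
  (Q.*≤* (subst₂ ℤ._≤_ (sym (ℤP.*-identityˡ (ℤ.+ suc a))) (sym (ℤP.*-identityˡ (ℤ.+ suc b)))
    (ℤ.+≤+ (s≤s a≤b))))

inv-cancel : ∀ n → ℕtoℚ (suc n) *ℚ inv (suc n) ≡ 1ℚ
inv-cancel n = trans (cong₂ _*ℚ_ (ℕtoℚ-mkℚ (suc n)) (inv-mkℚ n))
  (QP.*-inverseʳ (mkℚ (ℤ.+ suc n) 0 (Coprime.sym (Coprime.1-coprimeTo (suc n)))))

inv-unique : ∀ n q → ℕtoℚ (suc n) *ℚ q ≡ 1ℚ → q ≡ inv (suc n)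
inv-unique n q nq≡1 = begin
  q                                         ≡⟨ sym (QP.*-identityˡ q) ⟩
  1ℚ *ℚ q                                   ≡⟨ cong (_*ℚ q) (sym (trans (QP.*-comm (inv (suc n)) _) (inv-cancel n))) ⟩
  (inv (suc n) *ℚ ℕtoℚ (suc n)) *ℚ q        ≡⟨ QP.*-assoc (inv (suc n)) _ q ⟩
  inv (suc n) *ℚ (ℕtoℚ (suc n) *ℚ q)        ≡⟨ cong (inv (suc n) *ℚ_) nq≡1 ⟩
  inv (suc n) *ℚ 1ℚ                         ≡⟨ QP.*-identityʳ _ ⟩
  inv (suc n)                               ∎
  where open ≡-Reasoning

inv-* : ∀ a b → 1 ≤ a → 1 ≤ b → inv (a * b) ≡ inv a *ℚ inv b
inv-* (suc a) (suc b) _ _ = sym (inv-unique (b + a * suc b) _ (begin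
  ℕtoℚ (suc a * suc b) *ℚ (inv (suc a) *ℚ inv (suc b))
    ≡⟨ cong (_*ℚ (inv (suc a) *ℚ inv (suc b))) (ℕtoℚ-* (suc a) (suc b)) ⟩
  (ℕtoℚ (suc a) *ℚ ℕtoℚ (suc b)) *ℚ (inv (suc a) *ℚ inv (suc b))
    ≡⟨ solve 4 (λ x y u v → (x :* y) :* (u :* v) := (x :* u) :* (y :* v)) refl
         (ℕtoℚ (suc a)) (ℕtoℚ (suc b)) (inv (suc a)) (inv (suc b)) ⟩
  (ℕtoℚ (suc a) *ℚ inv (suc a)) *ℚ (ℕtoℚ (suc b) *ℚ inv (suc b))
    ≡⟨ cong₂ _*ℚ_ (inv-cancel a) (inv-cancel b) ⟩
  1ℚ ∎))
  where open ≡-Reasoning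

prodℚ-inv : ∀ a k → 1 ≤ a → prodℚ {k} (λ _ → inv a) ≡ inv (a ^ k)
prodℚ-inv a       zero    _   = refl
prodℚ-inv (suc a) (suc k) 1≤a = trans (cong (inv (suc a) *ℚ_) (prodℚ-inv (suc a) k 1≤a))
  (sym (inv-* (suc a) (suc a ^ k) 1≤a (ℕP.m^n>0 (suc a) k)))

sumℚ-cong : ∀ {n} {f g : Fin n → ℚ} → (∀ i → f i ≡ g i) → sumℚ f ≡ sumℚ g
sumℚ-cong {zero}  f≡g = refl
sumℚ-cong {suc n} f≡g = cong₂ _+ℚ_ (f≡g zero) (sumℚ-cong (λ i → f≡g (suc i)))

sumℚ-mono : ∀ {n} {f g : Fin n → ℚ} → (∀ i → f i ≤ℚ g i) → sumℚ f ≤ℚ sumℚ g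
sumℚ-mono {zero}  f≤g = QP.≤-refl
sumℚ-mono {suc n} f≤g = QP.+-mono-≤ (f≤g zero) (sumℚ-mono (λ i → f≤g (suc i)))

sumℚ-scale : ∀ {n} K (f : Fin n → ℕ) → sumℚ (λ i → K *ℚ ℕtoℚ (f i)) ≡ K *ℚ ℕtoℚ (sumℕ f)
sumℚ-scale {zero}  K f = sym (QP.*-zeroʳ K)
sumℚ-scale {suc n} K f = begin
  K *ℚ ℕtoℚ (f zero) +ℚ sumℚ (λ i → K *ℚ ℕtoℚ (f (suc i)))
    ≡⟨ cong (K *ℚ ℕtoℚ (f zero) +ℚ_) (sumℚ-scale K (λ i → f (suc i))) ⟩
  K *ℚ ℕtoℚ (f zero) +ℚ K *ℚ ℕtoℚ (sumℕ (λ i → f (suc i)))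
    ≡⟨ sym (QP.*-distribˡ-+ K _ _) ⟩
  K *ℚ (ℕtoℚ (f zero) +ℚ ℕtoℚ (sumℕ (λ i → f (suc i))))
    ≡⟨ cong (K *ℚ_) (sym (ℕtoℚ-+ (f zero) _)) ⟩
  K *ℚ ℕtoℚ (sumℕ f) ∎
  where open ≡-Reasoning

sumSeq-mono : ∀ N m {f g : Vector (Fin N) m → ℚ} → (∀ w → f w ≤ℚ g w) →
  sumSeq N m f ≤ℚ sumSeq N m g
sumSeq-mono N zero    f≤g = f≤g _
sumSeq-mono N (suc m) f≤g = sumℚ-mono (λ x → sumSeq-mono N m (λ w → f≤g (x ∷ w)))

sumSeq-indicator : ∀ N m K (b : Vector (Fin N) m → Bool) →
  sumSeq N m (λ w → if b w then K else 0ℚ) ≡ K *ℚ ℕtoℚ (sumSeqℕ N m (λ w → 𝟙 (b w)))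
sumSeq-indicator N zero    K b = indicator (b (λ ()))
  where
  indicator : ∀ c → (if c then K else 0ℚ) ≡ K *ℚ ℕtoℚ (𝟙 c)
  indicator true  = sym (QP.*-identityʳ K)
  indicator false = sym (QP.*-zeroʳ K)
sumSeq-indicator N (suc m) K b = trans
  (sumℚ-cong (λ x → sumSeq-indicator N m K (λ w → b (x ∷ w))))
  (sumℚ-scale K (λ x → sumSeqℕ N m (λ w → 𝟙 (b (x ∷ w)))))

prodℚ-nonneg : ∀ {n} (f : Fin n → ℚ) → (∀ i → 0ℚ ≤ℚ f i) → 0ℚ ≤ℚ prodℚ f
prodℚ-nonneg {zero}  f 0≤f = Q.*≤* (ℤ.+≤+ z≤n)
prodℚ-nonneg {suc n} f 0≤f = QP.nonNegative⁻¹ _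
  {{QP.nonNeg*nonNeg⇒nonNeg (f zero) {{Q.nonNegative (0≤f zero)}}
    _ {{Q.nonNegative (prodℚ-nonneg _ (λ i → 0≤f (suc i)))}}}}

prodℚ-mono : ∀ {n} {f g : Fin n → ℚ} → (∀ i → 0ℚ ≤ℚ f i) → (∀ i → f i ≤ℚ g i) →
  prodℚ f ≤ℚ prodℚ g
prodℚ-mono {zero}          0≤f f≤g = QP.≤-refl
prodℚ-mono {suc n} {f} {g} 0≤f f≤g = QP.≤-trans
  (QP.*-monoʳ-≤-nonNeg (prodℚ (λ i → f (suc i)))
    {{Q.nonNegative (prodℚ-nonneg _ (λ i → 0≤f (suc i)))}} (f≤g zero))
  (QP.*-monoˡ-≤-nonNeg (g zero) {{Q.nonNegative (QP.≤-trans (0≤f zero) (f≤g zero))}}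
    (prodℚ-mono (λ i → 0≤f (suc i)) (λ i → f≤g (suc i))))

module WalkBound {N : ℕ} (G : Graph N) (k : ℕ) where
  open SimplePaths G k

  stepProb : (Fin (suc k) → Fin N) → Fin k → ℚ
  stepProb w i = if adj G (w (inject₁ i)) (w (suc i)) then inv (deg G (w (inject₁ i))) else 0ℚ

  stepProb-nonneg : ∀ w i → 0ℚ ≤ℚ stepProb w i
  stepProb-nonneg w i with adj G (w (inject₁ i)) (w (suc i))
  ... | true  = 0≤inv (deg G (w (inject₁ i)))
  ... | false = QP.≤-refl

  deg-pos : ∀ v u → adj G v u ≡ true → 1 ≤ deg G v
  deg-pos v u vu = ℕP.≤-trans (ℕP.≤-reflexive (cong 𝟙 (sym vu)))
    (term≤sumℕ (λ u → 𝟙 (adj G v u)) u)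

  stepProb-lower : ∀ d → MaxDegree≤ G (suc d) → ∀ w → isWalkB w ≡ true →
    ∀ i → inv (suc d) ≤ℚ stepProb w i
  stepProb-lower d maxdeg w walk i with adj G (w (inject₁ i)) (w (suc i)) in edge
  ... | false with () ← trans (sym edge) (allB-elim walk i)
  ... | true  with deg G (w (inject₁ i)) | deg-pos _ _ edge | maxdeg (w (inject₁ i))
  ...   | suc m | _ | s≤s m≤d = inv-antitone m≤d

  walkProb-nonneg : ∀ w → 0ℚ ≤ℚ walkProb G k w
  walkProb-nonneg w = QP.nonNegative⁻¹ _
    {{QP.nonNeg*nonNeg⇒nonNeg (inv N) {{inv-nonNeg N}}
      _ {{Q.nonNegative (prodℚ-nonneg (stepProb w) (stepProb-nonneg w))}}}}

  walkProb-lower : ∀ d → MaxDegree≤ G (suc d) → ∀ w → isWalkB w ≡ true →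
    inv N *ℚ inv (suc d ^ k) ≤ℚ walkProb G k w
  walkProb-lower d maxdeg w walk = QP.*-monoˡ-≤-nonNeg (inv N) {{inv-nonNeg N}} (begin
    inv (suc d ^ k)                  ≡⟨ sym (prodℚ-inv (suc d) k (s≤s z≤n)) ⟩
    prodℚ (λ (_ : Fin k) → inv (suc d)) ≤⟨ prodℚ-mono (λ _ → 0≤inv (suc d)) (stepProb-lower d maxdeg w walk) ⟩
    prodℚ (stepProb w)               ∎)
    where open QP.≤-Reasoning

  rejectWeight : (Fin (suc k) → Fin N) → ℚ
  rejectWeight w = if distinctB w then walkProb G k w else 0ℚ

  rejectWeight-nonneg : ∀ w → 0ℚ ≤ℚ rejectWeight w
  rejectWeight-nonneg w with distinctB w
  ... | true  = walkProb-nonneg w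
  ... | false = QP.≤-refl

  rejectProb-nonneg : 0ℚ ≤ℚ rejectProb G k
  rejectProb-nonneg = QP.≤-trans (QP.≤-reflexive zero-sum) (sumSeq-mono N (suc k) zero≤weight)
    where
    zero-sum : 0ℚ ≡ sumSeq N (suc k) (λ w → if isSimplePathB w then 0ℚ else 0ℚ)
    zero-sum = sym (trans (sumSeq-indicator N (suc k) 0ℚ isSimplePathB) (QP.*-zeroˡ (ℕtoℚ totalPaths)))
    zero≤weight : ∀ w → (if isSimplePathB w then 0ℚ else 0ℚ) ≤ℚ rejectWeight w
    zero≤weight w with isSimplePathB w
    ... | true  = rejectWeight-nonneg w
    ... | false = rejectWeight-nonneg w

  rejectProb-lower : ∀ d → MaxDegree≤ G (suc d) →
    (inv N *ℚ inv (suc d ^ k)) *ℚ ℕtoℚ totalPaths ≤ℚ rejectProb G k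
  rejectProb-lower d maxdeg = begin
    K *ℚ ℕtoℚ totalPaths                                      ≡⟨ sym (sumSeq-indicator N (suc k) K isSimplePathB) ⟩
    sumSeq N (suc k) (λ w → if isSimplePathB w then K else 0ℚ) ≤⟨ sumSeq-mono N (suc k) path≤weight ⟩
    rejectProb G k                                            ∎
    where
    open QP.≤-Reasoning
    K = inv N *ℚ inv (suc d ^ k)
    path≤weight : ∀ w → (if isSimplePathB w then K else 0ℚ) ≤ℚ rejectWeight w
    path≤weight w with distinctB w in distinct | isWalkB w in walk
    ... | true  | true  = walkProb-lower d maxdeg w walk
    ... | true  | false = walkProb-nonneg w
    ... | false | _     = QP.≤-refl

far⇒many-paths : ∀ {N} (G : Graph N) k d ε → 1 ≤ k → MaxDegree≤ G d → EpsFar ε d k G →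
  ε *ℚ ℕtoℚ (d * N) Q.< ℕtoℚ (d * SimplePaths.totalPaths G k + d * SimplePaths.totalPaths G k)
far⇒many-paths G k d ε 1≤k maxdeg far = QP.<-≤-trans
  (far (Repair.repaired G k) (repaired-free G k 1≤k))
  (ℕtoℚ-mono (Repair.repair-cost G k d maxdeg))

-- a graph without vertices is at distance 0 from the (P_k-free) empty graph
empty-not-far : ∀ (G : Graph 0) k d ε → ¬ EpsFar ε d k G
empty-not-far G k d ε far = QP.<-irrefl refl (begin-strict
  0ℚ                  ≡⟨ sym (QP.*-zeroʳ ε) ⟩
  ε *ℚ ℕtoℚ 0         ≡⟨ cong (λ m → ε *ℚ ℕtoℚ m) (sym (ℕP.*-zeroʳ d)) ⟩
  ε *ℚ ℕtoℚ (d * 0)   <⟨ far G (λ p _ → no-vertex (p zero)) ⟩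
  0ℚ                  ∎)
  where
  open QP.≤-Reasoning
  no-vertex : Fin 0 → ⊥
  no-vertex ()

rescale : ∀ ε d n D P → 1 ≤ d → 1 ≤ n → 1 ≤ D →
  ε *ℚ ℕtoℚ (d * n) ≤ℚ ℕtoℚ (d * P + d * P) →
  ε *ℚ inv (2 * D) ≤ℚ (inv n *ℚ inv D) *ℚ ℕtoℚ P
rescale ε (suc d) (suc n) (suc D) P _ _ _ hyp =
  subst₂ _≤ℚ_ lhs rhs (QP.*-monoʳ-≤-nonNeg r {{r-nonNeg}} hyp)
  where
  open ≡-Reasoning
  a  = ℕtoℚ (suc d)
  b  = ℕtoℚ (suc n)
  p  = ℕtoℚ P
  ia = inv (suc d)
  ib = inv (suc n)
  i2 = inv 2
  iD = inv (suc D)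
  r  = ia *ℚ ib *ℚ (i2 *ℚ iD)
  r-nonNeg : Q.NonNegative r
  r-nonNeg = QP.nonNeg*nonNeg⇒nonNeg (ia *ℚ ib)
    {{QP.nonNeg*nonNeg⇒nonNeg ia {{inv-nonNeg (suc d)}} ib {{inv-nonNeg (suc n)}}}}
    (i2 *ℚ iD) {{QP.nonNeg*nonNeg⇒nonNeg i2 {{inv-nonNeg 2}} iD {{inv-nonNeg (suc D)}}}}
  lhs : ε *ℚ ℕtoℚ (suc d * suc n) *ℚ r ≡ ε *ℚ inv (2 * suc D)
  lhs = begin
    ε *ℚ ℕtoℚ (suc d * suc n) *ℚ r
      ≡⟨ cong (λ x → ε *ℚ x *ℚ r) (ℕtoℚ-* (suc d) (suc n)) ⟩
    ε *ℚ (a *ℚ b) *ℚ r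
      ≡⟨ solve 7 (λ e x y u v s t → e :* (x :* y) :* (u :* v :* (s :* t))
                                 := (e :* (s :* t)) :* ((x :* u) :* (y :* v))) refl ε a b ia ib i2 iD ⟩
    ε *ℚ (i2 *ℚ iD) *ℚ ((a *ℚ ia) *ℚ (b *ℚ ib))
      ≡⟨ cong₂ (λ x y → ε *ℚ (i2 *ℚ iD) *ℚ (x *ℚ y)) (inv-cancel d) (inv-cancel n) ⟩
    ε *ℚ (i2 *ℚ iD) *ℚ (1ℚ *ℚ 1ℚ)
      ≡⟨ QP.*-identityʳ _ ⟩
    ε *ℚ (i2 *ℚ iD)
      ≡⟨ cong (ε *ℚ_) (sym (inv-* 2 (suc D) (s≤s z≤n) (s≤s z≤n))) ⟩
    ε *ℚ inv (2 * suc D) ∎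
  rhs : ℕtoℚ (suc d * P + suc d * P) *ℚ r ≡ (ib *ℚ iD) *ℚ p
  rhs = begin
    ℕtoℚ (suc d * P + suc d * P) *ℚ r
      ≡⟨ cong (_*ℚ r) (trans (ℕtoℚ-+ (suc d * P) _) (cong₂ _+ℚ_ (ℕtoℚ-* (suc d) P) (ℕtoℚ-* (suc d) P))) ⟩
    (a *ℚ p +ℚ a *ℚ p) *ℚ r
      ≡⟨ solve 7 (λ q x y u v s t → (x :* q :+ x :* q) :* (u :* v :* (s :* t))
                                 := (v :* t :* q) :* ((x :* u) :* ((con 1ℚ :+ con 1ℚ) :* s))) refl p a b ia ib i2 iD ⟩
    ib *ℚ iD *ℚ p *ℚ ((a *ℚ ia) *ℚ ((1ℚ +ℚ 1ℚ) *ℚ i2))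
      ≡⟨ cong₂ (λ x y → ib *ℚ iD *ℚ p *ℚ (x *ℚ y)) (inv-cancel d) (inv-cancel 1) ⟩
    ib *ℚ iD *ℚ p *ℚ (1ℚ *ℚ 1ℚ)
      ≡⟨ QP.*-identityʳ _ ⟩
    (ib *ℚ iD) *ℚ p ∎

claim7p3 : ∀ {N : ℕ} (k d : ℕ) (ε : ℚ) (G : Graph N) →
    1 ≤ k → MaxDegree≤ G d → EpsFar ε d k G →
    ε *ℚ inv (2 * d ^ k) ≤ℚ rejectProb G k
-- for d = 0 the bound is ε·0 = 0
claim7p3 (suc k) zero ε G _ _ _ =
  subst (_≤ℚ rejectProb G (suc k)) (sym (QP.*-zeroʳ ε)) (WalkBound.rejectProb-nonneg G (suc k))
claim7p3 {zero} k (suc d) ε G _ _ far = ⊥-elim (empty-not-far G k (suc d) ε far)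
claim7p3 {suc n} k (suc d) ε G 1≤k maxdeg far = begin
  ε *ℚ inv (2 * suc d ^ k)
    ≤⟨ rescale ε (suc d) (suc n) (suc d ^ k) P (s≤s z≤n) (s≤s z≤n) (ℕP.m^n>0 (suc d) k)
         (QP.<⇒≤ (far⇒many-paths G k (suc d) ε 1≤k maxdeg far)) ⟩
  (inv (suc n) *ℚ inv (suc d ^ k)) *ℚ ℕtoℚ P
    ≤⟨ WalkBound.rejectProb-lower G k d maxdeg ⟩
  rejectProb G k ∎
  where
  open QP.≤-Reasoning
  P = SimplePaths.totalPaths G k
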